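{- For every formula $A$ of intuitionistic propositional logic, every proof of $A$ in $\mathsf{L(IL)}$ (i.e. of the labeled sequent $\Rightarrow w:A$) can be step-wise translated into a proof of $A$ in the nested sequent calculus $\mathsf{N(IL)}$ (i.e. of the nested sequent $\Rightarrow A$).
   Context: Formulas: $A::=p\mid\bot\mid A\lor A\mid A\land A\mid A\supset A$. Labeled sequents are $\mathcal{R},\Gamma\Rightarrow\Delta$ with $\mathcal{R}$ a multiset of relational atoms $w\leq u$ and $\Gamma,\Delta$ multisets of labeled formulas $w:A$. $\mathsf{L(IL)}$ rules: $(id)$: $\mathcal{R},w\leq u,\Gamma,w:p\Rightarrow u:p,\Delta$; $(\bot_l)$: $\mathcal{R},w\leq u,\Gamma,w:\bot\Rightarrow\Delta$; $(\supset_r)$: from $\mathcal{R},w\leq u,\Gamma,u:A\Rightarrow u:B,\Delta$ infer $\mathcal{R},\Gamma\Rightarrow w:A\supset B,\Delta$ with $u$ fresh; $(\lor_l)$: from $\mathcal{R},\Gamma,w:A\Rightarrow\Delta$ and $\mathcal{R},\Gamma,w:B\Rightarrow\Delta$ infer $\mathcal{R},\Gamma,w:A\lor B\Rightarrow\Delta$; $(\lor_r)$: from $\mathcal{R},\Gamma\Rightarrow w:A,w:B,\Delta$ infer $\mathcal{R},\Gamma\Rightarrow w:A\lor B,\Delta$; $(\land_l)$: from $\mathcal{R},\Gamma,w:A,w:B\Rightarrow\Delta$ infer $\mathcal{R},\Gamma,w:A\land B\Rightarrow\Delta$; $(\land_r)$: from $\mathcal{R},\Gamma\Rightarrow w:A,\Delta$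 and $\mathcal{R},\Gamma\Rightarrow w:B,\Delta$ infer $\mathcal{R},\Gamma\Rightarrow w:A\land B,\Delta$; $(\supset_l)$: from $\mathcal{R},w\leq u,\Gamma,w:A\supset B,u:B\Rightarrow\Delta$ and $\mathcal{R},w\leq u,\Gamma,w:A\supset B\Rightarrow u:A,\Delta$ infer $\mathcal{R},w\leq u,\Gamma,w:A\supset B\Rightarrow\Delta$; $(ref)$: from $\mathcal{R},w\leq w,\Gamma\Rightarrow\Delta$ infer $\mathcal{R},\Gamma\Rightarrow\Delta$; $(tra)$: from $\mathcal{R},w\leq u,u\leq v,w\leq v,\Gamma\Rightarrow\Delta$ infer $\mathcal{R},w\leq u,u\leq v,\Gamma\Rightarrow\Delta$. Nested sequents of $\mathsf{N(IL)}$ are generated by $\Sigma::=\Gamma\Rightarrow\Gamma\mid\Sigma,[\Sigma]_w$ with $\Gamma$ a multiset of formulas; they encode trees whose nodes are Gentzen sequents, each node carrying a distinct label (the root has label $r$). $\Sigma\{\Gamma\Rightarrow\Delta\}_w$ denotes a nested sequent with node $w$ equal to $\Gamma\Rightarrow\Delta$ (plus its nested children); $u$ is reachable from $w$ if there is a (possibly length-0) path from $w$ to $u$ in the tree. Rules of $\mathsf{N(IL)}$: $(id)$: $\Sigma\{\Gamma_1,p\Rightarrow\Delta_1\}_w\{\Gamma_2\Rightarrow p,\Delta_2\}_u$ with $u$ reachable from $w$; $(\bot_l)$: $\Sigma\{\Gamma,\bot\Rightarrow\Delta\}_w$; $(\lor_l),(\lor_r),(\land_l),(\land_r)$: the Gentzen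 rules applied at a single node $w$; $(\supset_l)$: from $\Sigma\{\Gamma_1,A\supset B\Rightarrow\Delta_1\}_w\{\Gamma_2,B\Rightarrow\Delta_2\}_u$ and $\Sigma\{\Gamma_1,A\supset B\Rightarrow\Delta_1\}_w\{\Gamma_2\Rightarrow A,\Delta_2\}_u$ infer $\Sigma\{\Gamma_1,A\supset B\Rightarrow\Delta_1\}_w\{\Gamma_2\Rightarrow\Delta_2\}_u$, with $u$ reachable from $w$; $(\supset_r)$: from $\Sigma\{\Gamma\Rightarrow\Delta,[A\Rightarrow B]_u\}_w$ infer $\Sigma\{\Gamma\Rightarrow\Delta,A\supset B\}_w$ ($u$ a new label). -}

module Defs where

open import Data.Nat using (ℕ)
open import Data.Product using (_×_; _,_; proj₁; proj₂; ∃)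
open import Data.List using (List; []; _∷_; _++_; map)
open import Data.List.Membership.Propositional using (_∈_; _∉_)
open import Data.List.Relation.Binary.Permutation.Propositional using (_↭_)
open import Relation.Binary.PropositionalEquality using (_≡_)

data Fml : Set where
  atom : ℕ → Fml
  bot  : Fml
  _∨̇_  : Fml → Fml → Fml
  _∧̇_  : Fml → Fml → Fml
  _⊃̇_  : Fml → Fml → Fml

-- Labels are natural numbers; a relational atom w ≤ u is the pair (w , u);
-- a labeled formula w : A is the pair (w , A).
-- Multisets are represented by lists; multiset contexts of the rules are
-- rendered either by membership (when the principal part is kept in the
-- conclusion and premises) or by permutation (_↭_) splitting off the
-- principal part.

Label : Set
Label = ℕ

Rel : Set
Rel = List (Label × Label)

LFmls : Set
LFmls = List (Label × Fml)

labels : Rel → LFmls → LFmls → List Label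
labels R Γ Δ = map proj₁ R ++ map proj₂ R ++ map proj₁ Γ ++ map proj₁ Δ

data LIL : Rel → LFmls → LFmls → Set where
  id   : ∀ {R Γ Δ w u p} → (w , u) ∈ R → (w , atom p) ∈ Γ → (u , atom p) ∈ Δ →
         LIL R Γ Δ
  botl : ∀ {R Γ Δ w u} → (w , u) ∈ R → (w , bot) ∈ Γ → LIL R Γ Δ
  impr : ∀ {R Γ Δ Δ' w u A B} → Δ ↭ ((w , A ⊃̇ B) ∷ Δ') → u ∉ labels R Γ Δ →
         LIL ((w , u) ∷ R) ((u , A) ∷ Γ) ((u , B) ∷ Δ') → LIL R Γ Δ
  orl  : ∀ {R Γ Γ' Δ w A B} → Γ ↭ ((w , A ∨̇ B) ∷ Γ') →
         LIL R ((w , A) ∷ Γ') Δ → LIL R ((w , B) ∷ Γ') Δ → LIL R Γ Δ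
  orr  : ∀ {R Γ Δ Δ' w A B} → Δ ↭ ((w , A ∨̇ B) ∷ Δ') →
         LIL R Γ ((w , A) ∷ (w , B) ∷ Δ') → LIL R Γ Δ
  andl : ∀ {R Γ Γ' Δ w A B} → Γ ↭ ((w , A ∧̇ B) ∷ Γ') →
         LIL R ((w , A) ∷ (w , B) ∷ Γ') Δ → LIL R Γ Δ
  andr : ∀ {R Γ Δ Δ' w A B} → Δ ↭ ((w , A ∧̇ B) ∷ Δ') →
         LIL R Γ ((w , A) ∷ Δ') → LIL R Γ ((w , B) ∷ Δ') → LIL R Γ Δ
  impl : ∀ {R Γ Δ w u A B} → (w , u) ∈ R → (w , A ⊃̇ B) ∈ Γ →
         LIL R ((u , B) ∷ Γ) Δ → LIL R Γ ((u , A) ∷ Δ) → LIL R Γ Δ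
  ref  : ∀ {R Γ Δ} (w : Label) → LIL ((w , w) ∷ R) Γ Δ → LIL R Γ Δ
  tra  : ∀ {R R' Γ Δ w u v} → R ↭ ((w , u) ∷ (u , v) ∷ R') →
         LIL ((w , v) ∷ R) Γ Δ → LIL R Γ Δ

-- Nested sequents of N(IL): finite trees whose nodes are Gentzen sequents
-- Γ ⇒ Δ (lists as multisets).  Node labels serve only to address nodes;
-- we address nodes by one-hole contexts instead.

data NSeq : Set where
  node : List Fml → List Fml → List NSeq → NSeq

data Ctx : Set where
  hole : Ctx
  down : List Fml → List Fml → List NSeq → Ctx → List NSeq → Ctx

plug : Ctx → NSeq → NSeq
plug hole t = t
plug (down Γ Δ ls C rs) t = node Γ Δ (ls ++ plug C t ∷ rs)

data NIL : NSeq → Set where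
  -- Σ{Γ1, p ⇒ Δ1}_w {Γ2 ⇒ p, Δ2}_u, u reachable from w (D = hole: u = w)
  id   : ∀ {C D Γ₁ Δ₁ ch Γ₂ Δ₂ ch₂ p} →
         node Γ₁ Δ₁ ch ≡ plug D (node Γ₂ Δ₂ ch₂) →
         atom p ∈ Γ₁ → atom p ∈ Δ₂ → NIL (plug C (node Γ₁ Δ₁ ch))
  botl : ∀ {C Γ Δ ch} → bot ∈ Γ → NIL (plug C (node Γ Δ ch))
  orl  : ∀ {C Γ Γ' Δ ch A B} → Γ ↭ (A ∨̇ B ∷ Γ') →
         NIL (plug C (node (A ∷ Γ') Δ ch)) → NIL (plug C (node (B ∷ Γ') Δ ch)) →
         NIL (plug C (node Γ Δ ch))
  orr  : ∀ {C Γ Δ Δ' ch A B} → Δ ↭ (A ∨̇ B ∷ Δ') →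
         NIL (plug C (node Γ (A ∷ B ∷ Δ') ch)) → NIL (plug C (node Γ Δ ch))
  andl : ∀ {C Γ Γ' Δ ch A B} → Γ ↭ (A ∧̇ B ∷ Γ') →
         NIL (plug C (node (A ∷ B ∷ Γ') Δ ch)) → NIL (plug C (node Γ Δ ch))
  andr : ∀ {C Γ Δ Δ' ch A B} → Δ ↭ (A ∧̇ B ∷ Δ') →
         NIL (plug C (node Γ (A ∷ Δ') ch)) → NIL (plug C (node Γ (B ∷ Δ') ch)) →
         NIL (plug C (node Γ Δ ch))
  -- Σ{Γ1, A⊃B ⇒ Δ1}_w {Γ2 ⇒ Δ2}_u, u reachable from w
  impl : ∀ {C D Γ₁ Δ₁ ch Γ₂ Δ₂ ch₂ A B} →
         node Γ₁ Δ₁ ch ≡ plug D (node Γ₂ Δ₂ ch₂) → (A ⊃̇ B) ∈ Γ₁ →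
         NIL (plug C (plug D (node (B ∷ Γ₂) Δ₂ ch₂))) →
         NIL (plug C (plug D (node Γ₂ (A ∷ Δ₂) ch₂))) →
         NIL (plug C (node Γ₁ Δ₁ ch))
  impr : ∀ {C Γ Δ Δ' ch A B} → Δ ↭ (A ⊃̇ B ∷ Δ') →
         NIL (plug C (node Γ Δ' (node (A ∷ []) (B ∷ []) [] ∷ ch))) →
         NIL (plug C (node Γ Δ ch))

-- The L(IL) derivation is translated bottom-up, rule by rule, while carrying a finite tree S
-- of labels.  The nested sequent associated with R, Γ ⇒ Δ is S with each node w filled with
-- the formulas of Γ and Δ labelled w.  The invariant is that the labels of S are distinct,
-- include the labels of all formulas and occur in the labelled sequent, and that every
-- relational atom w ≤ u of R is a path of tree edges, so u lies in the subtree below w.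
-- Then (ref) and (tra) merely enlarge R, (⊃r) grafts its fresh eigenlabel as a new child of
-- w, (id) and (⊃l) act on the node w and a node u of its subtree, and the remaining rules
-- act on the node of their principal label.  Node contents are determined by the labelled
-- multisets only up to permutation, which N(IL) absorbs because it is closed under
-- permuting the formulas inside nodes.

module Submission where

open import Defs
open import Data.Empty using (⊥-elim)
open import Data.Product using (Σ-syntax; _×_; _,_; proj₁; proj₂)
open import Data.Sum using (_⊎_; inj₁; inj₂; [_,_]′)
import Data.Sum as Sum
open import Data.Maybe using (Maybe; just; nothing)
open import Data.Nat using (_≟_)
open import Data.List using (List; []; _∷_; _++_; map; mapMaybe)
open import Data.List.Properties using (++-assoc; ++-identityʳ; ∷-injective)
open import Data.List.Membership.Propositional using (_∈_; _∉_)
open import Data.List.Membership.Propositional.Properties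
  using (∈-++⁺ˡ; ∈-++⁺ʳ; ∈-++⁻; ∈-∃++; ∈-insert; ∈-map⁺)
open import Data.List.Relation.Unary.Any using (here; there)
import Data.List.Relation.Unary.All as All
import Data.List.Relation.Unary.All.Properties as All
open import Data.List.Relation.Unary.Unique.Propositional using (Unique; []; _∷_)
open import Data.List.Relation.Unary.Unique.Propositional.Properties using (Unique[x∷xs]⇒x∉xs)
open import Data.List.Relation.Binary.Subset.Propositional using (_⊆_)
open import Data.List.Relation.Binary.Subset.Propositional.Properties
  using (⊆-refl; ++⁺; ∈-∷⁺ʳ; xs⊆x∷xs)
  renaming (map⁺ to ⊆-map⁺)
open import Data.List.Relation.Binary.Permutation.Propositional
  using (_↭_; ↭-refl; ↭-reflexive; ↭-sym; ↭-trans; prep; ↭⇒↭ₛ; module PermutationReasoning)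
open import Data.List.Relation.Binary.Permutation.Propositional.Properties
  using (∈-resp-↭; ++⁺ˡ; ++⁺ʳ; shift; shifts; mapMaybe-↭)
  renaming (map⁺ to ↭-map⁺)
import Data.List.Relation.Binary.Permutation.Setoid.Properties as Setoidᴾ
open import Relation.Binary.Construct.Closure.ReflexiveTransitive using (Star; ε; _◅_; _◅◅_)
import Relation.Binary.Construct.Closure.ReflexiveTransitive as Star
open import Relation.Binary.PropositionalEquality
  using (setoid; _≡_; _≢_; refl; sym; trans; cong; subst; module ≡-Reasoning)
open import Relation.Nullary using (yes; no)
open import Function using (_∘_)

-- Permuting formulas inside nodes

infix 4 _≈_ _≈*_ _≈ᶜ_

data _≈_ : NSeq → NSeq → Set
data _≈*_ : List NSeq → List NSeq → Set

data _≈_ where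
  node : ∀ {Γ Γ′ Δ Δ′ ch ch′} → Γ ↭ Γ′ → Δ ↭ Δ′ → ch ≈* ch′ → node Γ Δ ch ≈ node Γ′ Δ′ ch′

data _≈*_ where
  []  : [] ≈* []
  _∷_ : ∀ {t t′ ts ts′} → t ≈ t′ → ts ≈* ts′ → t ∷ ts ≈* t′ ∷ ts′

data _≈ᶜ_ : Ctx → Ctx → Set where
  hole : hole ≈ᶜ hole
  down : ∀ {Γ Γ′ Δ Δ′ ls ls′ C C′ rs rs′} → Γ ↭ Γ′ → Δ ↭ Δ′ → ls ≈* ls′ → C ≈ᶜ C′ → rs ≈* rs′ →
         down Γ Δ ls C rs ≈ᶜ down Γ′ Δ′ ls′ C′ rs′

≈*-++ : ∀ {ls ls′ rs rs′} → ls ≈* ls′ → rs ≈* rs′ → ls ++ rs ≈* ls′ ++ rs′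
≈*-++ []       q = q
≈*-++ (e ∷ es) q = e ∷ ≈*-++ es q

record Split (ls : List NSeq) (t : NSeq) (rs : List NSeq) (ys : List NSeq) : Set where
  constructor split
  field
    {ls′ rs′} : List NSeq
    {t′}      : NSeq
    ys≡       : ys ≡ ls′ ++ t′ ∷ rs′
    left      : ls ≈* ls′
    middle    : t ≈ t′
    right     : rs ≈* rs′

≈*-split : ∀ ls {t rs ys} → ls ++ t ∷ rs ≈* ys → Split ls t rs ys
≈*-split []       (e ∷ es) = split refl [] e es
≈*-split (_ ∷ ls) (e ∷ es) with ≈*-split ls es
... | split refl l m r = split refl (e ∷ l) m r

plug-≈ : ∀ {C C′ t t′} → C ≈ᶜ C′ → t ≈ t′ → plug C t ≈ plug C′ t′
plug-≈ hole             e = e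
plug-≈ (down p q l c r) e = node p q (≈*-++ l (plug-≈ c e ∷ r))

record PlugMatch (C : Ctx) (t : NSeq) (Y : NSeq) : Set where
  constructor match
  field
    {C′} : Ctx
    {t′} : NSeq
    Y≡       : Y ≡ plug C′ t′
    context≈ : C ≈ᶜ C′
    plugged≈ : t ≈ t′

plug-≈⁻ : ∀ C {t Y} → plug C t ≈ Y → PlugMatch C t Y
plug-≈⁻ hole                 e = match refl hole e
plug-≈⁻ (down Γ Δ ls C rs) (node p q s) with ≈*-split ls s
... | split refl l m r with plug-≈⁻ C m
...   | match refl c e = match refl (down p q l c r) e

exchange : ∀ {X Y} → NIL X → X ≈ Y → NIL Y
exchange (id {C} {D} eq a b) e with plug-≈⁻ C e
... | match refl c (node p q s) with plug-≈⁻ D (subst (_≈ _) eq (node p q s))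
...   | match eq′ _ (node _ q′ _) = id eq′ (∈-resp-↭ p a) (∈-resp-↭ q′ b)
exchange (botl {C} b) e with plug-≈⁻ C e
... | match refl _ (node p _ _) = botl (∈-resp-↭ p b)
exchange (orl {C} π d₁ d₂) e with plug-≈⁻ C e
... | match refl c (node p q s) =
  orl (↭-trans (↭-sym p) π) (exchange d₁ (plug-≈ c (node ↭-refl q s)))
                            (exchange d₂ (plug-≈ c (node ↭-refl q s)))
exchange (orr {C} π d) e with plug-≈⁻ C e
... | match refl c (node p q s) =
  orr (↭-trans (↭-sym q) π) (exchange d (plug-≈ c (node p ↭-refl s)))
exchange (andl {C} π d) e with plug-≈⁻ C e
... | match refl c (node p q s) =
  andl (↭-trans (↭-sym p) π) (exchange d (plug-≈ c (node ↭-refl q s)))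
exchange (andr {C} π d₁ d₂) e with plug-≈⁻ C e
... | match refl c (node p q s) =
  andr (↭-trans (↭-sym q) π) (exchange d₁ (plug-≈ c (node p ↭-refl s)))
                             (exchange d₂ (plug-≈ c (node p ↭-refl s)))
exchange (impl {C} {D} eq a d₁ d₂) e with plug-≈⁻ C e
... | match refl c (node p q s) with plug-≈⁻ D (subst (_≈ _) eq (node p q s))
...   | match eq′ c′ (node p′ q′ s′) =
  impl eq′ (∈-resp-↭ p a) (exchange d₁ (plug-≈ c (plug-≈ c′ (node (prep _ p′) q′ s′))))
                          (exchange d₂ (plug-≈ c (plug-≈ c′ (node p′ (prep _ q′) s′))))
exchange (impr {C} π d) e with plug-≈⁻ C e
... | match refl c (node p q s) =
  impr (↭-trans (↭-sym q) π) (exchange d (plug-≈ c (node p ↭-refl (node ↭-refl ↭-refl [] ∷ s))))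

-- Trees of labels

data Shape : Set where
  sh : Label → List Shape → Shape

data ShapeCtx : Set where
  top    : ShapeCtx
  inside : Label → List Shape → ShapeCtx → List Shape → ShapeCtx

plugˢ : ShapeCtx → Shape → Shape
plugˢ top              t = t
plugˢ (inside w ls C rs) t = sh w (ls ++ plugˢ C t ∷ rs)

_⨾_ : ShapeCtx → ShapeCtx → ShapeCtx
top              ⨾ D = D
inside w ls C rs ⨾ D = inside w ls (C ⨾ D) rs

plugˢ-⨾ : ∀ C D t → plugˢ (C ⨾ D) t ≡ plugˢ C (plugˢ D t)
plugˢ-⨾ top              D t = refl
plugˢ-⨾ (inside w ls C rs) D t = cong (λ x → sh w (ls ++ x ∷ rs)) (plugˢ-⨾ C D t)

root : Shape → Label
root (sh w _) = w

root-plugˢ : ∀ C {w ch ch′} → root (plugˢ C (sh w ch)) ≡ root (plugˢ C (sh w ch′))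
root-plugˢ top              = refl
root-plugˢ (inside _ _ _ _) = refl

labelsˢ : Shape → List Label
labelsᶠ : List Shape → List Label
labelsˢ (sh w ch) = w ∷ labelsᶠ ch
labelsᶠ []       = []
labelsᶠ (t ∷ ts) = labelsˢ t ++ labelsᶠ ts

labelsᶜ : ShapeCtx → List Label
labelsᶜ top                = []
labelsᶜ (inside w ls C rs) = w ∷ labelsᶠ ls ++ labelsᶜ C ++ labelsᶠ rs

labelsᶠ-++ : ∀ xs ys → labelsᶠ (xs ++ ys) ≡ labelsᶠ xs ++ labelsᶠ ys
labelsᶠ-++ []       ys = refl
labelsᶠ-++ (x ∷ xs) ys =
  trans (cong (labelsˢ x ++_) (labelsᶠ-++ xs ys)) (sym (++-assoc (labelsˢ x) _ _))

labelsˢ-plug : ∀ C t → labelsˢ (plugˢ C t) ↭ labelsˢ t ++ labelsᶜ C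
labelsˢ-plug top t = ↭-reflexive (sym (++-identityʳ (labelsˢ t)))
labelsˢ-plug (inside w ls C rs) t = begin
  w ∷ labelsᶠ (ls ++ plugˢ C t ∷ rs)              ≡⟨ cong (w ∷_) (labelsᶠ-++ ls _) ⟩
  w ∷ (L ++ labelsˢ (plugˢ C t) ++ R)         ↭⟨ prep w (++⁺ˡ L (++⁺ʳ R (labelsˢ-plug C t))) ⟩
  w ∷ (L ++ (T ++ labelsᶜ C) ++ R)            ≡⟨ cong (λ xs → w ∷ L ++ xs) (++-assoc T _ R) ⟩
  w ∷ (L ++ T ++ labelsᶜ C ++ R)              ↭⟨ prep w (shifts L T) ⟩
  w ∷ (T ++ L ++ labelsᶜ C ++ R)              ↭⟨ shift w T _ ⟨
  T ++ w ∷ L ++ labelsᶜ C ++ R                ∎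
  where
  open PermutationReasoning
  L = labelsᶠ ls
  R = labelsᶠ rs
  T = labelsˢ t

∈-plugˢ : ∀ C {t v} → v ∈ labelsˢ t → v ∈ labelsˢ (plugˢ C t)
∈-plugˢ C {t} p = ∈-resp-↭ (↭-sym (labelsˢ-plug C t)) (∈-++⁺ˡ p)

∈-labelsᶠ : ∀ {t ch v} → t ∈ ch → v ∈ labelsˢ t → v ∈ labelsᶠ ch
∈-labelsᶠ (here refl) p = ∈-++⁺ˡ p
∈-labelsᶠ {ch = t ∷ _} (there q) p = ∈-++⁺ʳ (labelsˢ t) (∈-labelsᶠ q p)

Unique-++⁻ʳ : ∀ xs {ys : List Label} → Unique (xs ++ ys) → Unique ys
Unique-++⁻ʳ []       u       = u
Unique-++⁻ʳ (_ ∷ xs) (_ ∷ u) = Unique-++⁻ʳ xs u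

Unique-++⁻ˡ : ∀ xs {ys : List Label} → Unique (xs ++ ys) → Unique xs
Unique-++⁻ˡ []       u         = []
Unique-++⁻ˡ (_ ∷ xs) (x∉ ∷ u) = All.++⁻ˡ xs x∉ ∷ Unique-++⁻ˡ xs u

Unique-++-disjoint : ∀ xs {ys : List Label} {v} → Unique (xs ++ ys) → v ∈ xs → v ∉ ys
Unique-++-disjoint (_ ∷ xs) (x∉ ∷ _) (here refl) q = All.lookup x∉ (∈-++⁺ʳ xs q) refl
Unique-++-disjoint (_ ∷ xs) (_ ∷ u)  (there p)   q = Unique-++-disjoint xs u p q

Unique-resp-↭ : ∀ {xs ys : List Label} → xs ↭ ys → Unique xs → Unique ys
Unique-resp-↭ p = Setoidᴾ.Unique-resp-↭ (setoid Label) (↭⇒↭ₛ p)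

Unique-plugˢ : ∀ C t → Unique (labelsˢ (plugˢ C t)) → Unique (labelsˢ t)
Unique-plugˢ C t u = Unique-++⁻ˡ (labelsˢ t) (Unique-resp-↭ (labelsˢ-plug C t) u)

record Occurrence (w : Label) (S : Shape) : Set where
  constructor occurrence
  field
    context       : ShapeCtx
    children      : List Shape
    decomposition : S ≡ plugˢ context (sh w children)

  subtree : Shape
  subtree = sh w children

open Occurrence public

occurrence-child : ∀ v ls rs {t w} → Occurrence w t → Occurrence w (sh v (ls ++ t ∷ rs))
occurrence-child v ls rs o =
  occurrence (inside v ls (context o) rs) (children o)
    (cong (λ x → sh v (ls ++ x ∷ rs)) (decomposition o))

_⊙_ : ∀ {a b S} (o : Occurrence a S) → Occurrence b (subtree o) → Occurrence b S
o ⊙ i = occurrence (context o ⨾ context i) (children i) (begin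
  _                                              ≡⟨ decomposition o ⟩
  plugˢ (context o) (subtree o)                   ≡⟨ cong (plugˢ (context o)) (decomposition i) ⟩
  plugˢ (context o) (plugˢ (context i) (subtree i)) ≡⟨ plugˢ-⨾ (context o) (context i) _ ⟨
  plugˢ (context o ⨾ context i) (subtree i)        ∎)
  where open ≡-Reasoning

focus  : ∀ S {w} → w ∈ labelsˢ S → Occurrence w S
focusᶠ : ∀ v ls ch {w} → w ∈ labelsᶠ ch → Occurrence w (sh v (ls ++ ch))
focus (sh v ch) (here refl) = occurrence top ch refl
focus (sh v ch) (there p)   = focusᶠ v [] ch p
focusᶠ v ls (t ∷ ts) p with ∈-++⁻ (labelsˢ t) p
... | inj₁ q = occurrence-child v ls ts (focus t q)
... | inj₂ q =
  subst (λ ch → Occurrence _ (sh v ch)) (++-assoc ls (t ∷ []) ts) (focusᶠ v (ls ++ t ∷ []) ts q)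

branches : Shape → List Shape
branches (sh _ ch) = ch

child-unique : ∀ ls ls′ {x x′ rs rs′ w} → Unique (labelsᶠ (ls ++ x ∷ rs)) →
               ls ++ x ∷ rs ≡ ls′ ++ x′ ∷ rs′ → w ∈ labelsˢ x → w ∈ labelsˢ x′ → x ≡ x′
child-unique []       []        u refl p q = refl
child-unique []       (y ∷ ls′) u refl p q =
  ⊥-elim (Unique-++-disjoint (labelsˢ y) u p (∈-labelsᶠ (∈-insert ls′) q))
child-unique (y ∷ ls) []        u refl p q =
  ⊥-elim (Unique-++-disjoint (labelsˢ y) u q (∈-labelsᶠ (∈-insert ls) p))
child-unique (y ∷ ls) (_ ∷ ls′) u eq   p q =
  child-unique ls ls′ (Unique-++⁻ʳ (labelsˢ y) u) (proj₂ (∷-injective eq)) p q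

plugˢ-unique : ∀ C C′ {w ch ch′} → Unique (labelsˢ (plugˢ C (sh w ch))) →
               plugˢ C (sh w ch) ≡ plugˢ C′ (sh w ch′) → ch ≡ ch′
plugˢ-unique top top u refl = refl
plugˢ-unique top (inside _ ls C rs) u refl =
  ⊥-elim (Unique[x∷xs]⇒x∉xs u (∈-labelsᶠ (∈-insert ls) (∈-plugˢ C (here refl))))
plugˢ-unique (inside _ ls C rs) top u refl =
  ⊥-elim (Unique[x∷xs]⇒x∉xs u (∈-labelsᶠ (∈-insert ls) (∈-plugˢ C (here refl))))
plugˢ-unique (inside v ls C rs) (inside _ ls′ C′ rs′) u@(_ ∷ u′) eq =
  plugˢ-unique C C′ (Unique-plugˢ (inside v ls top rs) _ u)
    (child-unique ls ls′ u′ (cong branches eq) (∈-plugˢ C (here refl)) (∈-plugˢ C′ (here refl)))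

occurrence-unique : ∀ {w S} → Unique (labelsˢ S) → (o o′ : Occurrence w S) →
                    children o ≡ children o′
occurrence-unique u o o′ =
  plugˢ-unique (context o) (context o′) (subst (Unique ∘ labelsˢ) (decomposition o) u)
    (trans (sym (decomposition o)) (decomposition o′))

Below : Shape → Label → Label → Set
Below S a b = Σ[ o ∈ Occurrence a S ] b ∈ labelsˢ (subtree o)

below-self : ∀ {S a} → a ∈ labelsˢ S → Below S a a
below-self {S} p = focus S p , here refl

below-∈ : ∀ {S a b} → Below S a b → b ∈ labelsˢ S
below-∈ (o , p) = subst (λ X → _ ∈ labelsˢ X) (sym (decomposition o)) (∈-plugˢ (context o) p)

below-trans : ∀ {S a b c} → Unique (labelsˢ S) → Below S a b → Below S b c → Below S a c
below-trans {c = c} u (o , b∈) (o′ , c∈) =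
  o , subst (λ X → c ∈ labelsˢ X) (sym (decomposition i)) (∈-plugˢ (context i) c∈ᵢ)
  where
  i = focus (subtree o) b∈
  c∈ᵢ : c ∈ labelsˢ (subtree i)
  c∈ᵢ = subst (λ ch → c ∈ labelsˢ (sh _ ch)) (sym (occurrence-unique u (o ⊙ i) o′)) c∈

data Edge : Shape → Label → Label → Set where
  child  : ∀ {w ch t} → t ∈ ch → Edge (sh w ch) w (root t)
  deeper : ∀ {w ch t a b} → t ∈ ch → Edge t a b → Edge (sh w ch) a b

edge-below : ∀ {S a b} → Edge S a b → Below S a b
edge-below (child {ch = ch} {t = sh _ _} p) = occurrence top ch refl , there (∈-labelsᶠ p (here refl))
edge-below (deeper p e) with ∈-∃++ p
... | ls , rs , refl = let (o , q) = edge-below e in occurrence-child _ ls rs o , q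

reach-below : ∀ {S a b} → Unique (labelsˢ S) → a ∈ labelsˢ S → Star (Edge S) a b → Below S a b
reach-below u a∈ ε        = below-self a∈
reach-below u a∈ (e ◅ es) = below-trans u (edge-below e) (reach-below u (below-∈ (edge-below e)) es)

graft : ∀ {w S} → Occurrence w S → Shape → Shape
graft {w} o x = plugˢ (context o) (sh w (x ∷ children o))

grafted : ∀ {w S} (o : Occurrence w S) x → Occurrence w (graft o x)
grafted o x = occurrence (context o) (x ∷ children o) refl

labelsˢ-graft : ∀ {w S} (o : Occurrence w S) x → labelsˢ (graft o x) ↭ labelsˢ x ++ labelsˢ S
labelsˢ-graft {w} {S} o x = begin
  labelsˢ (plugˢ C (sh w (x ∷ ch)))           ↭⟨ labelsˢ-plug C _ ⟩
  w ∷ (X ++ labelsᶠ ch) ++ labelsᶜ C          ≡⟨ cong (w ∷_) (++-assoc X _ _) ⟩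
  w ∷ X ++ labelsᶠ ch ++ labelsᶜ C            ↭⟨ shift w X _ ⟨
  X ++ w ∷ labelsᶠ ch ++ labelsᶜ C            ↭⟨ ++⁺ˡ X (labelsˢ-plug C _) ⟨
  X ++ labelsˢ (plugˢ C (sh w ch))            ≡⟨ cong (λ T → X ++ labelsˢ T) (decomposition o) ⟨
  X ++ labelsˢ S                              ∎
  where
  open PermutationReasoning
  C = context o
  ch = children o
  X = labelsˢ x

middle-view : ∀ (ls : List Shape) {y y′ rs t} → t ∈ ls ++ y ∷ rs → t ≡ y ⊎ t ∈ ls ++ y′ ∷ rs
middle-view []       (here eq) = inj₁ eq
middle-view []       (there p) = inj₂ (there p)
middle-view (_ ∷ ls) (here eq) = inj₂ (here eq)
middle-view (_ ∷ ls) (there p) = Sum.map₂ there (middle-view ls p)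

edge-plug-graft : ∀ C {w ch x a b} → Edge (plugˢ C (sh w ch)) a b →
                  Edge (plugˢ C (sh w (x ∷ ch))) a b
edge-plug-graft top (child p)    = child (there p)
edge-plug-graft top (deeper p e) = deeper (there p) e
edge-plug-graft (inside _ ls C _) (child p) with middle-view ls p
... | inj₁ refl = subst (Edge _ _) (root-plugˢ C) (child (∈-insert ls))
... | inj₂ p′   = child p′
edge-plug-graft (inside _ ls C _) (deeper p e) with middle-view ls p
... | inj₁ refl = deeper (∈-insert ls) (edge-plug-graft C e)
... | inj₂ p′   = deeper p′ e

edge-graft : ∀ {w S a b} (o : Occurrence w S) x → Edge S a b → Edge (graft o x) a b
edge-graft o x e = edge-plug-graft (context o) (subst (λ T → Edge T _ _) (decomposition o) e)

edge-plug-grafted : ∀ C {w ch x} → Edge (plugˢ C (sh w (x ∷ ch))) w (root x)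
edge-plug-grafted top                = child (here refl)
edge-plug-grafted (inside _ ls C rs) = deeper (∈-insert ls) (edge-plug-grafted C)

edge-grafted : ∀ {w S} (o : Occurrence w S) x → Edge (graft o x) w (root x)
edge-grafted o x = edge-plug-grafted (context o)

-- The nested sequent of a labelled sequent on a tree of labels

formulaAt : Label → Label × Fml → Maybe Fml
formulaAt v (w , A) with w ≟ v
... | yes _ = just A
... | no  _ = nothing

infixl 6 _↾_

_↾_ : LFmls → Label → List Fml
Γ ↾ v = mapMaybe (formulaAt v) Γ

↾-here : ∀ {w v} A Γ → w ≡ v → ((w , A) ∷ Γ) ↾ v ≡ A ∷ Γ ↾ v
↾-here {w} {v} A Γ w≡v with w ≟ v
... | yes _   = refl
... | no  w≢v = ⊥-elim (w≢v w≡v)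

↾-there : ∀ {w v} A Γ → w ≢ v → ((w , A) ∷ Γ) ↾ v ≡ Γ ↾ v
↾-there {w} {v} A Γ w≢v with w ≟ v
... | yes w≡v = ⊥-elim (w≢v w≡v)
... | no  _   = refl

↾-↭ : ∀ {Γ Γ′} v → Γ ↭ Γ′ → Γ ↾ v ↭ Γ′ ↾ v
↾-↭ v = mapMaybe-↭ (formulaAt v)

↾-principal : ∀ {Γ Γ₀ w A} → Γ ↭ (w , A) ∷ Γ₀ → Γ ↾ w ↭ A ∷ Γ₀ ↾ w
↾-principal {Γ₀ = Γ₀} {A = A} π = ↭-trans (↾-↭ _ π) (↭-reflexive (↾-here A Γ₀ refl))

↾-side : ∀ {Γ Γ₀ w A v} → Γ ↭ (w , A) ∷ Γ₀ → w ≢ v → Γ ↾ v ↭ Γ₀ ↾ v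
↾-side {Γ₀ = Γ₀} {A = A} π w≢v = ↭-trans (↾-↭ _ π) (↭-reflexive (↾-there A Γ₀ w≢v))

↾-∈ : ∀ {Γ w A} → (w , A) ∈ Γ → A ∈ Γ ↾ w
↾-∈ p with ∈-∃++ p
... | xs , ys , refl = ∈-resp-↭ (↭-sym (↾-principal (shift _ xs ys))) (here refl)

↾-fresh : ∀ {w} Γ → w ∉ map proj₁ Γ → Γ ↾ w ≡ []
↾-fresh []            _  = refl
↾-fresh ((v , A) ∷ Γ) w∉ =
  trans (↾-there A Γ (λ v≡w → w∉ (here (sym v≡w)))) (↾-fresh Γ (w∉ ∘ there))

realize  : LFmls → LFmls → Shape → NSeq
realizeᶠ : LFmls → LFmls → List Shape → List NSeq
realize Γ Δ (sh w ch) = node (Γ ↾ w) (Δ ↾ w) (realizeᶠ Γ Δ ch)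
realizeᶠ Γ Δ []       = []
realizeᶠ Γ Δ (t ∷ ts) = realize Γ Δ t ∷ realizeᶠ Γ Δ ts

realizeᶜ : LFmls → LFmls → ShapeCtx → Ctx
realizeᶜ Γ Δ top                = hole
realizeᶜ Γ Δ (inside w ls C rs) =
  down (Γ ↾ w) (Δ ↾ w) (realizeᶠ Γ Δ ls) (realizeᶜ Γ Δ C) (realizeᶠ Γ Δ rs)

realizeᶠ-++ : ∀ Γ Δ xs ys → realizeᶠ Γ Δ (xs ++ ys) ≡ realizeᶠ Γ Δ xs ++ realizeᶠ Γ Δ ys
realizeᶠ-++ Γ Δ []       ys = refl
realizeᶠ-++ Γ Δ (x ∷ xs) ys = cong (realize Γ Δ x ∷_) (realizeᶠ-++ Γ Δ xs ys)

realize-plug : ∀ Γ Δ C t → realize Γ Δ (plugˢ C t) ≡ plug (realizeᶜ Γ Δ C) (realize Γ Δ t)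
realize-plug Γ Δ top                t = refl
realize-plug Γ Δ (inside w ls C rs) t =
  cong (node (Γ ↾ w) (Δ ↾ w)) (trans (realizeᶠ-++ Γ Δ ls (plugˢ C t ∷ rs))
    (cong (λ x → realizeᶠ Γ Δ ls ++ x ∷ realizeᶠ Γ Δ rs) (realize-plug Γ Δ C t)))

realize-at : ∀ {Γ Δ w S} (o : Occurrence w S) →
             realize Γ Δ S ≡ plug (realizeᶜ Γ Δ (context o)) (realize Γ Δ (subtree o))
realize-at {Γ} {Δ} o = trans (cong (realize Γ Δ) (decomposition o)) (realize-plug Γ Δ (context o) _)

plug-realizeᶜ-⨾ : ∀ Γ Δ C D t →
                  plug (realizeᶜ Γ Δ (C ⨾ D)) t ≡ plug (realizeᶜ Γ Δ C) (plug (realizeᶜ Γ Δ D) t)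
plug-realizeᶜ-⨾ Γ Δ top                D t = refl
plug-realizeᶜ-⨾ Γ Δ (inside w ls C rs) D t =
  cong (λ x → node (Γ ↾ w) (Δ ↾ w) (realizeᶠ Γ Δ ls ++ x ∷ realizeᶠ Γ Δ rs)) (plug-realizeᶜ-⨾ Γ Δ C D t)

record Agree (Γ′ Δ′ Γ Δ : LFmls) (v : Label) : Set where
  constructor _,_
  field
    left  : Γ′ ↾ v ↭ Γ ↾ v
    right : Δ′ ↾ v ↭ Δ ↾ v

module _ {Γ′ Δ′ Γ Δ : LFmls} where

  realize-cong  : ∀ t → (∀ {v} → v ∈ labelsˢ t → Agree Γ′ Δ′ Γ Δ v) →
                  realize Γ′ Δ′ t ≈ realize Γ Δ t
  realizeᶠ-cong : ∀ ts → (∀ {v} → v ∈ labelsᶠ ts → Agree Γ′ Δ′ Γ Δ v) →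
                  realizeᶠ Γ′ Δ′ ts ≈* realizeᶠ Γ Δ ts
  realize-cong (sh w ch) agree =
    node (Agree.left (agree (here refl))) (Agree.right (agree (here refl)))
      (realizeᶠ-cong ch (agree ∘ there))
  realizeᶠ-cong []       agree = []
  realizeᶠ-cong (t ∷ ts) agree =
    realize-cong t (agree ∘ ∈-++⁺ˡ) ∷ realizeᶠ-cong ts (agree ∘ ∈-++⁺ʳ (labelsˢ t))

  realizeᶜ-cong : ∀ C → (∀ {v} → v ∈ labelsᶜ C → Agree Γ′ Δ′ Γ Δ v) →
                  realizeᶜ Γ′ Δ′ C ≈ᶜ realizeᶜ Γ Δ C
  realizeᶜ-cong top                agree = hole
  realizeᶜ-cong (inside w ls C rs) agree =
    down (Agree.left (agree (here refl))) (Agree.right (agree (here refl)))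
      (realizeᶠ-cong ls (agree ∘ there ∘ ∈-++⁺ˡ))
      (realizeᶜ-cong C (agree ∘ there ∘ ∈-++⁺ʳ (labelsᶠ ls) ∘ ∈-++⁺ˡ))
      (realizeᶠ-cong rs (agree ∘ there ∘ ∈-++⁺ʳ (labelsᶠ ls) ∘ ∈-++⁺ʳ (labelsᶜ C)))

descend : ∀ {Γ′ Δ′ Γ Δ w S t} (o : Occurrence w S) →
          (∀ {v} → v ∈ labelsᶜ (context o) → Agree Γ′ Δ′ Γ Δ v) → realize Γ′ Δ′ (subtree o) ≈ t →
          NIL (realize Γ′ Δ′ S) → NIL (plug (realizeᶜ Γ Δ (context o)) t)
descend o agree e d =
  exchange (subst NIL (realize-at o) d) (plug-≈ (realizeᶜ-cong (context o) agree) e)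

around : ∀ {w S v} → Unique (labelsˢ S) → (o : Occurrence w S) →
         v ∈ labelsᶠ (children o) ++ labelsᶜ (context o) → v ∈ labelsˢ S × v ≢ w
around {w} u o p =
  subst (λ X → _ ∈ labelsˢ X) (sym (decomposition o)) (∈-resp-↭ (↭-sym labels-o) (there p)) ,
  λ { refl → Unique[x∷xs]⇒x∉xs (Unique-resp-↭ labels-o (subst (Unique ∘ labelsˢ) (decomposition o) u)) p }
  where
  labels-o : labelsˢ (plugˢ (context o) (subtree o)) ↭ w ∷ labelsᶠ (children o) ++ labelsᶜ (context o)
  labels-o = labelsˢ-plug (context o) (subtree o)

module _ {Γ′ Δ′ Γ Δ Γₙ Δₙ w S} (u : Unique (labelsˢ S)) (o : Occurrence w S)
         (agree : ∀ {v} → v ∈ labelsˢ S → v ≢ w → Agree Γ′ Δ′ Γ Δ v)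
         (p : Γ′ ↾ w ↭ Γₙ) (q : Δ′ ↾ w ↭ Δₙ) where

  private
    agree-around : ∀ {v} → v ∈ labelsᶠ (children o) ++ labelsᶜ (context o) → Agree Γ′ Δ′ Γ Δ v
    agree-around r = agree (proj₁ (around u o r)) (proj₂ (around u o r))

  descend-node : NIL (realize Γ′ Δ′ S) →
                 NIL (plug (realizeᶜ Γ Δ (context o)) (node Γₙ Δₙ (realizeᶠ Γ Δ (children o))))
  descend-node = descend o (agree-around ∘ ∈-++⁺ʳ _)
    (node p q (realizeᶠ-cong (children o) (agree-around ∘ ∈-++⁺ˡ)))

  descend-graft : ∀ {x t} → realize Γ′ Δ′ x ≈ t → NIL (realize Γ′ Δ′ (graft o x)) →
                  NIL (plug (realizeᶜ Γ Δ (context o)) (node Γₙ Δₙ (t ∷ realizeᶠ Γ Δ (children o))))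
  descend-graft {x} e = descend (grafted o x) (agree-around ∘ ∈-++⁺ʳ _)
    (node p q (e ∷ realizeᶠ-cong (children o) (agree-around ∘ ∈-++⁺ˡ)))

-- The translation

⊆-++ : ∀ {A : Set} {xs ys zs : List A} → xs ⊆ zs → ys ⊆ zs → xs ++ ys ⊆ zs
⊆-++ {xs = xs} f g p = [ f , g ]′ (∈-++⁻ xs p)

labels⁺ : ∀ {R R′ Γ Γ′ Δ Δ′} → R ⊆ R′ → map proj₁ Γ ⊆ map proj₁ Γ′ → map proj₁ Δ ⊆ map proj₁ Δ′ →
          labels R Γ Δ ⊆ labels R′ Γ′ Δ′
labels⁺ r g d = ++⁺ (⊆-map⁺ proj₁ r) (++⁺ (⊆-map⁺ proj₂ r) (++⁺ g d))

module _ {R : Rel} {Γ Δ : LFmls} where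

  source∈labels : map proj₁ R ⊆ labels R Γ Δ
  source∈labels = ∈-++⁺ˡ

  target∈labels : map proj₂ R ⊆ labels R Γ Δ
  target∈labels = ∈-++⁺ʳ (map proj₁ R) ∘ ∈-++⁺ˡ

  left∈labels : map proj₁ Γ ⊆ labels R Γ Δ
  left∈labels = ∈-++⁺ʳ (map proj₁ R) ∘ ∈-++⁺ʳ (map proj₂ R) ∘ ∈-++⁺ˡ

  right∈labels : map proj₁ Δ ⊆ labels R Γ Δ
  right∈labels = ∈-++⁺ʳ (map proj₁ R) ∘ ∈-++⁺ʳ (map proj₂ R) ∘ ∈-++⁺ʳ (map proj₁ Γ)

record Represents (R : Rel) (Γ Δ : LFmls) (S : Shape) : Set where
  field
    unique  : Unique (labelsˢ S)
    coversΓ : map proj₁ Γ ⊆ labelsˢ S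
    coversΔ : map proj₁ Δ ⊆ labelsˢ S
    scoped  : labelsˢ S ⊆ labels R Γ Δ    -- so the eigenlabel of (⊃r) is not yet in S
    reaches : ∀ {a b} → (a , b) ∈ R → Star (Edge S) a b

open Represents

principal : ∀ {Γ Γ₀ : LFmls} {w X} → Γ ↭ (w , X) ∷ Γ₀ → w ∈ map proj₁ Γ
principal π = ∈-resp-↭ (↭-sym (↭-map⁺ proj₁ π)) (here refl)

module _ {R Γ Δ S} (rep : Represents R Γ Δ S) where

  updateΓ : ∀ Γ′ → map proj₁ Γ′ ⊆ labelsˢ S → map proj₁ Γ ⊆ map proj₁ Γ′ → Represents R Γ′ Δ S
  updateΓ Γ′ covers grow = record
    { unique  = unique rep
    ; coversΓ = covers
    ; coversΔ = coversΔ rep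
    ; scoped  = labels⁺ {R} {R} {Γ} {Γ′} {Δ} {Δ} ⊆-refl grow ⊆-refl ∘ scoped rep
    ; reaches = reaches rep
    }

  updateΔ : ∀ Δ′ → map proj₁ Δ′ ⊆ labelsˢ S → map proj₁ Δ ⊆ map proj₁ Δ′ → Represents R Γ Δ′ S
  updateΔ Δ′ covers grow = record
    { unique  = unique rep
    ; coversΓ = coversΓ rep
    ; coversΔ = covers
    ; scoped  = labels⁺ {R} {R} {Γ} {Γ} {Δ} {Δ′} ⊆-refl ⊆-refl grow ∘ scoped rep
    ; reaches = reaches rep
    }

  replaceΓ : ∀ {Γ₀ w X} Γ′ → Γ ↭ (w , X) ∷ Γ₀ →
             map proj₁ Γ′ ⊆ w ∷ map proj₁ Γ₀ → w ∷ map proj₁ Γ₀ ⊆ map proj₁ Γ′ → Represents R Γ′ Δ S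
  replaceΓ Γ′ π sub sup =
    updateΓ Γ′ (coversΓ rep ∘ ∈-resp-↭ (↭-sym (↭-map⁺ proj₁ π)) ∘ sub) (sup ∘ ∈-resp-↭ (↭-map⁺ proj₁ π))

  replaceΔ : ∀ {Δ₀ w X} Δ′ → Δ ↭ (w , X) ∷ Δ₀ →
             map proj₁ Δ′ ⊆ w ∷ map proj₁ Δ₀ → w ∷ map proj₁ Δ₀ ⊆ map proj₁ Δ′ → Represents R Γ Δ′ S
  replaceΔ Δ′ π sub sup =
    updateΔ Δ′ (coversΔ rep ∘ ∈-resp-↭ (↭-sym (↭-map⁺ proj₁ π)) ∘ sub) (sup ∘ ∈-resp-↭ (↭-map⁺ proj₁ π))

  extendR : ∀ {x} → (∀ {a b} → (a , b) ∈ x ∷ R → Star (Edge S) a b) → Represents (x ∷ R) Γ Δ S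
  extendR r = record
    { unique  = unique rep
    ; coversΓ = coversΓ rep
    ; coversΔ = coversΔ rep
    ; scoped  = labels⁺ {Γ = Γ} {Γ} {Δ} {Δ} (xs⊆x∷xs R _) ⊆-refl ⊆-refl ∘ scoped rep
    ; reaches = r
    }

  graft-fresh : ∀ {Δ₀ w u A B X} (o : Occurrence w S) → Δ ↭ (w , X) ∷ Δ₀ → u ∉ labels R Γ Δ →
                Represents ((w , u) ∷ R) ((u , A) ∷ Γ) ((u , B) ∷ Δ₀) (graft o (sh u []))
  graft-fresh {Δ₀} {w} {u} {A} {B} o π fresh = record
    { unique  = Unique-resp-↭ (↭-sym (labelsˢ-graft o leaf))
                  (All.¬Any⇒All¬ _ (fresh ∘ scoped rep) ∷ unique rep)
    ; coversΓ = ∈-∷⁺ʳ (grafted∈ (here refl)) (grafted∈ ∘ there ∘ coversΓ rep)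
    ; coversΔ = ∈-∷⁺ʳ (grafted∈ (here refl))
                  (grafted∈ ∘ there ∘ coversΔ rep ∘ ∈-resp-↭ (↭-sym π₁) ∘ there)
    ; scoped  = [ (λ { (here refl) → target∈labels {R′} {Γ′} {Δ′} (here refl) }) , old ]′
                ∘ ∈-++⁻ (u ∷ []) ∘ ∈-resp-↭ (labelsˢ-graft o leaf)
    ; reaches = λ { (here refl) → edge-grafted o leaf ◅ ε
                  ; (there p)   → Star.map (edge-graft o leaf) (reaches rep p) }
    }
    where
    leaf = sh u []
    R′ = (w , u) ∷ R
    Γ′ = (u , A) ∷ Γ
    Δ′ = (u , B) ∷ Δ₀
    π₁ = ↭-map⁺ proj₁ π
    grafted∈ : u ∷ labelsˢ S ⊆ labelsˢ (graft o leaf)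
    grafted∈ = ∈-resp-↭ (↭-sym (labelsˢ-graft o leaf))
    principal∈ : map proj₁ Δ ⊆ labels R′ Γ′ Δ′
    principal∈ q with ∈-resp-↭ π₁ q
    ... | here refl = source∈labels {R′} {Γ′} {Δ′} (here refl)
    ... | there q′  = right∈labels {R′} {Γ′} {Δ′} (there q′)
    old : labelsˢ S ⊆ labels R′ Γ′ Δ′
    old = ⊆-++ (source∈labels {R′} {Γ′} {Δ′} ∘ there) (⊆-++ (target∈labels {R′} {Γ′} {Δ′} ∘ there)
            (⊆-++ (left∈labels {R′} {Γ′} {Δ′} ∘ there) principal∈)) ∘ scoped rep

reached-∈ : ∀ {R Γ Δ S w u} → Represents R Γ Δ S → (w , u) ∈ R → w ∈ labelsˢ S → u ∈ labelsˢ S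
reached-∈ rep wu w∈ = below-∈ (reach-below (unique rep) w∈ (reaches rep wu))

agree-left : ∀ {Γ Γ₀ Γ′ Δ w X v} → Γ ↭ (w , X) ∷ Γ₀ → (w ≢ v → Γ′ ↾ v ≡ Γ₀ ↾ v) → v ≢ w →
             Agree Γ′ Δ Γ Δ v
agree-left π eq v≢w = ↭-trans (↭-reflexive (eq (v≢w ∘ sym))) (↭-sym (↾-side π (v≢w ∘ sym))) , ↭-refl

agree-right : ∀ {Γ Δ Δ₀ Δ′ w X v} → Δ ↭ (w , X) ∷ Δ₀ → (w ≢ v → Δ′ ↾ v ≡ Δ₀ ↾ v) → v ≢ w →
              Agree Γ Δ′ Γ Δ v
agree-right π eq v≢w = ↭-refl , ↭-trans (↭-reflexive (eq (v≢w ∘ sym))) (↭-sym (↾-side π (v≢w ∘ sym)))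

conclude : ∀ {Γ Δ w S} (o : Occurrence w S) →
           NIL (plug (realizeᶜ Γ Δ (context o)) (realize Γ Δ (subtree o))) → NIL (realize Γ Δ S)
conclude o = subst NIL (sym (realize-at o))

module _ {R Γ Δ S} (rep : Represents R Γ Δ S) where

  id-step : ∀ {w u p} → (w , u) ∈ R → (w , atom p) ∈ Γ → (u , atom p) ∈ Δ → NIL (realize Γ Δ S)
  id-step wu wp up = conclude o (NIL.id (realize-at i) (↾-∈ wp) (↾-∈ up))
    where
    below = reach-below (unique rep) (coversΓ rep (∈-map⁺ proj₁ wp)) (reaches rep wu)
    o = proj₁ below
    i = focus (subtree o) (proj₂ below)

  botl-step : ∀ {w} → (w , bot) ∈ Γ → NIL (realize Γ Δ S)
  botl-step wb = conclude o (NIL.botl (↾-∈ wb))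
    where o = focus S (coversΓ rep (∈-map⁺ proj₁ wb))

  orl-step : ∀ {Γ₀ w A B} → Γ ↭ (w , A ∨̇ B) ∷ Γ₀ →
             NIL (realize ((w , A) ∷ Γ₀) Δ S) → NIL (realize ((w , B) ∷ Γ₀) Δ S) → NIL (realize Γ Δ S)
  orl-step {Γ₀} {w} {A} {B} π d₁ d₂ =
    conclude o (NIL.orl (↾-principal π) (premise A d₁) (premise B d₂))
    where
    o = focus S (coversΓ rep (principal π))
    premise : ∀ C → NIL (realize ((w , C) ∷ Γ₀) Δ S) →
              NIL (plug (realizeᶜ Γ Δ (context o)) (node (C ∷ Γ₀ ↾ w) (Δ ↾ w) (realizeᶠ Γ Δ (children o))))
    premise C = descend-node {Γ′ = (w , C) ∷ Γ₀} {Δ′ = Δ} (unique rep) o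
      (λ _ → agree-left π (↾-there C Γ₀)) (↭-reflexive (↾-here C Γ₀ refl)) ↭-refl

  andl-step : ∀ {Γ₀ w A B} → Γ ↭ (w , A ∧̇ B) ∷ Γ₀ → NIL (realize ((w , A) ∷ (w , B) ∷ Γ₀) Δ S) →
              NIL (realize Γ Δ S)
  andl-step {Γ₀} {w} {A} {B} π d = conclude o (NIL.andl (↾-principal π)
    (descend-node {Γ′ = (w , A) ∷ (w , B) ∷ Γ₀} {Δ′ = Δ} (unique rep) o
      (λ _ → agree-left π (λ w≢v → trans (↾-there A ((w , B) ∷ Γ₀) w≢v) (↾-there B Γ₀ w≢v)))
      (↭-reflexive (trans (↾-here A ((w , B) ∷ Γ₀) refl) (cong (A ∷_) (↾-here B Γ₀ refl)))) ↭-refl d))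
    where o = focus S (coversΓ rep (principal π))

  orr-step : ∀ {Δ₀ w A B} → Δ ↭ (w , A ∨̇ B) ∷ Δ₀ → NIL (realize Γ ((w , A) ∷ (w , B) ∷ Δ₀) S) →
             NIL (realize Γ Δ S)
  orr-step {Δ₀} {w} {A} {B} π d = conclude o (NIL.orr (↾-principal π)
    (descend-node {Γ′ = Γ} {Δ′ = (w , A) ∷ (w , B) ∷ Δ₀} (unique rep) o
      (λ _ → agree-right π (λ w≢v → trans (↾-there A ((w , B) ∷ Δ₀) w≢v) (↾-there B Δ₀ w≢v)))
      ↭-refl (↭-reflexive (trans (↾-here A ((w , B) ∷ Δ₀) refl) (cong (A ∷_) (↾-here B Δ₀ refl)))) d))
    where o = focus S (coversΔ rep (principal π))

  andr-step : ∀ {Δ₀ w A B} → Δ ↭ (w , A ∧̇ B) ∷ Δ₀ →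
              NIL (realize Γ ((w , A) ∷ Δ₀) S) → NIL (realize Γ ((w , B) ∷ Δ₀) S) → NIL (realize Γ Δ S)
  andr-step {Δ₀} {w} {A} {B} π d₁ d₂ =
    conclude o (NIL.andr (↾-principal π) (premise A d₁) (premise B d₂))
    where
    o = focus S (coversΔ rep (principal π))
    premise : ∀ C → NIL (realize Γ ((w , C) ∷ Δ₀) S) →
              NIL (plug (realizeᶜ Γ Δ (context o)) (node (Γ ↾ w) (C ∷ Δ₀ ↾ w) (realizeᶠ Γ Δ (children o))))
    premise C = descend-node {Γ′ = Γ} {Δ′ = (w , C) ∷ Δ₀} (unique rep) o
      (λ _ → agree-right π (↾-there C Δ₀)) ↭-refl (↭-reflexive (↾-here C Δ₀ refl))

  impl-step : ∀ {w u A B} → (w , u) ∈ R → (w , A ⊃̇ B) ∈ Γ →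
              NIL (realize ((u , B) ∷ Γ) Δ S) → NIL (realize Γ ((u , A) ∷ Δ) S) → NIL (realize Γ Δ S)
  impl-step {u = u} {A} {B} wu wAB d₁ d₂ = conclude o (NIL.impl (realize-at i) (↾-∈ wAB)
    (at-u {Γ′ = (u , B) ∷ Γ} {Δ′ = Δ} (λ v≢u → ↭-reflexive (↾-there B Γ (v≢u ∘ sym)) , ↭-refl)
      (↭-reflexive (↾-here B Γ refl)) ↭-refl d₁)
    (at-u {Γ′ = Γ} {Δ′ = (u , A) ∷ Δ} (λ v≢u → ↭-refl , ↭-reflexive (↾-there A Δ (v≢u ∘ sym)))
      ↭-refl (↭-reflexive (↾-here A Δ refl)) d₂))
    where
    below = reach-below (unique rep) (coversΓ rep (∈-map⁺ proj₁ wAB)) (reaches rep wu)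
    o = proj₁ below
    i = focus (subtree o) (proj₂ below)
    at-u : ∀ {Γ′ Δ′ Γₙ Δₙ} → (∀ {v} → v ≢ u → Agree Γ′ Δ′ Γ Δ v) → Γ′ ↾ u ↭ Γₙ → Δ′ ↾ u ↭ Δₙ →
           NIL (realize Γ′ Δ′ S) →
           NIL (plug (realizeᶜ Γ Δ (context o))
                     (plug (realizeᶜ Γ Δ (context i)) (node Γₙ Δₙ (realizeᶠ Γ Δ (children i)))))
    at-u agree p q d = subst NIL (plug-realizeᶜ-⨾ Γ Δ (context o) (context i) _)
      (descend-node (unique rep) (o ⊙ i) (λ _ → agree) p q d)

  impr-step : ∀ {Δ₀ w u A B} (o : Occurrence w S) → Δ ↭ (w , A ⊃̇ B) ∷ Δ₀ → u ∉ labels R Γ Δ →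
              NIL (realize ((u , A) ∷ Γ) ((u , B) ∷ Δ₀) (graft o (sh u []))) → NIL (realize Γ Δ S)
  impr-step {Δ₀} {w} {u} {A} {B} o π fresh d = conclude o (NIL.impr (↾-principal π)
    (descend-graft (unique rep) o agree (↭-reflexive (↾-there A Γ (u≢ w∈S)))
      (↭-reflexive (↾-there B Δ₀ (u≢ w∈S))) leaf≈ d))
    where
    w∈S = coversΔ rep (principal π)
    u≢ : ∀ {v} → v ∈ labelsˢ S → u ≢ v
    u≢ v∈ refl = fresh (scoped rep v∈)
    agree : ∀ {v} → v ∈ labelsˢ S → v ≢ w → Agree ((u , A) ∷ Γ) ((u , B) ∷ Δ₀) Γ Δ v
    agree v∈ v≢w = ↭-reflexive (↾-there A Γ (u≢ v∈)) ,
                   ↭-trans (↭-reflexive (↾-there B Δ₀ (u≢ v∈))) (↭-sym (↾-side π (v≢w ∘ sym)))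
    leaf≈ : realize ((u , A) ∷ Γ) ((u , B) ∷ Δ₀) (sh u []) ≈ node (A ∷ []) (B ∷ []) []
    leaf≈ = node
      (↭-reflexive (trans (↾-here A Γ refl) (cong (A ∷_) (↾-fresh Γ (fresh ∘ left∈labels {R} {Γ} {Δ})))))
      (↭-reflexive (trans (↾-here B Δ₀ refl) (cong (B ∷_) (↾-fresh Δ₀
        (fresh ∘ right∈labels {R} {Γ} {Δ} ∘ ∈-resp-↭ (↭-sym (↭-map⁺ proj₁ π)) ∘ there)))))
      []

translate : ∀ {R Γ Δ S} → LIL R Γ Δ → Represents R Γ Δ S → NIL (realize Γ Δ S)
translate (id wu wp up) rep = id-step rep wu wp up
translate (botl _ wb)   rep = botl-step rep wb
translate (orl π d₁ d₂) rep =
  orl-step rep π (translate d₁ (replaceΓ rep _ π ⊆-refl ⊆-refl))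
                 (translate d₂ (replaceΓ rep _ π ⊆-refl ⊆-refl))
translate (andl π d)    rep =
  andl-step rep π (translate d (replaceΓ rep _ π (∈-∷⁺ʳ (here refl) ⊆-refl) there))
translate (orr π d)     rep =
  orr-step rep π (translate d (replaceΔ rep _ π (∈-∷⁺ʳ (here refl) ⊆-refl) there))
translate (andr π d₁ d₂) rep =
  andr-step rep π (translate d₁ (replaceΔ rep _ π ⊆-refl ⊆-refl))
                  (translate d₂ (replaceΔ rep _ π ⊆-refl ⊆-refl))
translate (impl {u = u} wu wAB d₁ d₂) rep = impl-step rep wu wAB
  (translate d₁ (updateΓ rep _ (∈-∷⁺ʳ u∈S (coversΓ rep)) (xs⊆x∷xs _ u)))
  (translate d₂ (updateΔ rep _ (∈-∷⁺ʳ u∈S (coversΔ rep)) (xs⊆x∷xs _ u)))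
  where u∈S = reached-∈ rep wu (coversΓ rep (∈-map⁺ proj₁ wAB))
translate (impr π fresh d) rep = impr-step rep o π fresh (translate d (graft-fresh rep o π fresh))
  where o = focus _ (coversΔ rep (principal π))
translate (ref w d) rep = translate d (extendR rep λ { (here refl) → ε ; (there p) → reaches rep p })
translate (tra π d) rep = translate d (extendR rep λ
  { (here refl) → reaches rep (∈-resp-↭ (↭-sym π) (here refl))
                  ◅◅ reaches rep (∈-resp-↭ (↭-sym π) (there (here refl)))
  ; (there p)   → reaches rep p })

lemma3p17 : (A : Fml) (w : Label) →
    LIL [] [] ((w , A) ∷ []) → NIL (node [] (A ∷ []) [])
lemma3p17 A w d = subst (λ Δₙ → NIL (node [] Δₙ [])) (↾-here {w} A [] refl) (translate d initial)
  where
  initial : Represents [] [] ((w , A) ∷ []) (sh w [])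
  initial = record
    { unique  = All.[] ∷ []
    ; coversΓ = λ ()
    ; coversΔ = λ p → p
    ; scoped  = λ p → p
    ; reaches = λ ()
    }
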